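{- In any locally-greedy asynchronous collective tree exploration algorithm, at any stage of the exploration every undiscovered edge lies below the anchor of some robot (i.e. in the subtree rooted at some anchor). Consequently, exploration is completed when all anchors are equal to $\perp$.
   Context: Asynchronous collective tree exploration (ACTE): $k$ robots start at the root of an unknown tree $T$. At each step $t$ an arbitrary (adversarially chosen) robot $r_t\in\{1,\dots,k\}$ is the only one allowed to move, and it moves along one adjacent edge. At the beginning of move $t$, the centrally controlled team is only additionally told whether $r_t$ is adjacent to an unexplored edge, and if so can move along it. A node is mined once all its adjacent edges are explored and the team has learned it has no further unexplored adjacent edge. An ACTE algorithm is locally-greedy if at every move $t$, whenever robot $r_t$ is adjacent to an unexplored edge, it moves along an unexplored edge. The anchor $a_t(r)$ of robot $r$ at time $t$ is the highest node that is not mined on the path from robot $r$'s position to the root, or $\perp$ if all nodes on this path are mined. -}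

module Defs where

open import Data.Nat using (ℕ; suc; _<_)
open import Data.Fin using (Fin; fromℕ<)
open import Data.List using (List; []; _∷_; _++_; [_]; length; lookup)
open import Data.Product using (Σ; ∃; _×_)
open import Data.Sum using (_⊎_)
open import Relation.Nullary using (¬_)
open import Relation.Binary.PropositionalEquality using (_≡_; _≢_)

data Tree : Set where
  node : List Tree → Tree

-- A node of a tree is addressed by the list of child indices on the
-- path from the root (the root is []).  The child number i of node p
-- is  p ++ [ i ].
Addr : Set
Addr = List ℕ

data _∈T_ : Addr → Tree → Set where
  root : ∀ {t} → [] ∈T t
  step : ∀ {ts i p} (h : i < length ts) →
         p ∈T lookup ts (fromℕ< h) → (i ∷ p) ∈T node ts

-- x is an ancestor of y (or equal): y lies in the subtree rooted at x.
_≼_ : Addr → Addr → Set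
x ≼ y = ∃ λ s → x ++ s ≡ y

-- Every edge of the tree is the pair (p , p ++ [ i ]), written as (p , i).
-- Edge (p , i) is incident to node v.
Incident : Addr → Addr → ℕ → Set
Incident v p i = (v ≡ p) ⊎ (v ≡ p ++ [ i ])

-- A run of k robots: at move s (s = 0,1,2,...) the adversarially chosen
-- robot  sched s  moves; pos s r is the position of robot r at the
-- beginning of move s (i.e. after s moves).

record Run (k : ℕ) : Set where
  field
    sched : ℕ → Fin k
    pos   : ℕ → Fin k → Addr
open Run public

module _ {k : ℕ} (R : Run k) where

  from to : ℕ → Addr
  from s = pos R s (sched R s)
  to   s = pos R (suc s) (sched R s)

  Trav : ℕ → Addr → ℕ → Set
  Trav s p i = (from s ≡ p × to s ≡ p ++ [ i ])
             ⊎ (to s ≡ p × from s ≡ p ++ [ i ])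

  Explored : ℕ → Addr → ℕ → Set
  Explored t p i = ∃ λ s → s < t × Trav s p i

  HasUnexploredEdge : Tree → ℕ → Addr → Set
  HasUnexploredEdge T s v =
    ∃ λ p → ∃ λ i → (p ++ [ i ]) ∈T T × Incident v p i × ¬ Explored s p i

  ValidUpTo : Tree → ℕ → Set
  ValidUpTo T t =
    (∀ r → pos R 0 r ≡ [])
    × (∀ s → s < t → ∀ r → r ≢ sched R s → pos R (suc s) r ≡ pos R s r)
    × (∀ s → s < t → to s ∈T T × ∃ λ p → ∃ λ i → Trav s p i)

  LocallyGreedyUpTo : Tree → ℕ → Set
  LocallyGreedyUpTo T t =
    ∀ s → s < t → HasUnexploredEdge T s (from s) →
      ∀ p i → Trav s p i → ¬ Explored s p i

  Mined : Tree → ℕ → Addr → Set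
  Mined T t v = ∃ λ s → s < t × from s ≡ v
                  × (∀ p i → (p ++ [ i ]) ∈T T → Incident v p i → Explored s p i)

  -- x is the anchor a_t(r): the highest non-mined node on the path from
  -- robot r's position to the root.  (a_t(r) = ⊥ iff no x is an anchor.)
  IsAnchor : Tree → ℕ → Fin k → Addr → Set
  IsAnchor T t r x = x ≼ pos R t r × ¬ Mined T t x
                     × (∀ y → y ≼ x → y ≢ x → Mined T t y)

{-# OPTIONS --safe #-}
-- Let (p , i) be an unexplored edge. Walking down from the root towards p, let x
-- be the first node that is not mined, so that every node above x is mined; p
-- itself is not mined since one of its edges is unexplored. If x is the root,
-- every robot lies below it. Otherwise the edge above x was explored, because
-- its upper end is mined, so some robot entered the subtree of x. No robot ever
-- leaves that subtree: a locally-greedy robot at x steps up along that explored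
-- edge only when x has no unexplored edge left, and this very move mines x.
-- Hence x is the anchor of a robot below it.
module Submission where

open import Defs
open import Data.Nat using (ℕ; zero; suc; _<_; _≤_; s≤s; z≤n; _+_; _≟_; _<?_)
open import Data.Nat.Properties
  using ( ≤-refl; ≤-trans; <⇒≤; <-≤-trans; m≤n⇒m≤1+n; m<1+n⇒m<n∨m≡n; m≤m+n; m≤n+m; n≤1+n
        ; <-irrelevant; anyUpTo?; allUpTo?)
open import Data.Fin using (Fin; fromℕ<; zero; suc) renaming (_≟_ to _≟ᶠ_)
open import Data.List using (List; []; _∷_; _++_; [_]; length; lookup; initLast; _∷ʳ′_)
open import Data.List.Properties
  using ( ++-assoc; ++-identityʳ; ++-identityʳ-unique; ++-conicalˡ; ++-conicalʳ
        ; ∷ʳ-injective; ∷ʳ-injectiveˡ; ≡-dec)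
open import Data.Product using (∃; _×_; _,_; proj₁; proj₂; map₂)
open import Data.Sum using (_⊎_; inj₁; inj₂; swap)
open import Function using (_∘_)
open import Relation.Nullary using (¬_; Dec; yes; no; contradiction)
open import Relation.Nullary.Decidable using (_×-dec_; _⊎-dec_; _→-dec_; map′; decidable-stable)
open import Relation.Unary using (Decidable)
open import Relation.Binary using (DecidableEquality)
open import Relation.Binary.PropositionalEquality using (_≡_; _≢_; refl; sym; trans; subst)

_≟ₐ_ : DecidableEquality Addr
_≟ₐ_ = ≡-dec _≟_

∷ʳ≢[] : ∀ (p : Addr) i → p ++ [ i ] ≢ []
∷ʳ≢[] p i e with ++-conicalʳ p [ i ] e
... | ()

≢-∷ʳ : ∀ (p : Addr) i → p ≢ p ++ [ i ]
≢-∷ʳ p i e with ++-identityʳ-unique p e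
... | ()

≼-refl : ∀ {x} → x ≼ x
≼-refl {x} = [] , ++-identityʳ x

≼-[] : ∀ {x} → x ≼ [] → x ≡ []
≼-[] {x} (s , e) = ++-conicalˡ x s e

≼-∷ʳ : ∀ {x p i} → x ≼ p → x ≼ (p ++ [ i ])
≼-∷ʳ {x} {p} {i} (s , refl) = s ++ [ i ] , sym (++-assoc x s [ i ])

≼-∷ʳ⁻ : ∀ {x p i} → x ≼ (p ++ [ i ]) → x ≼ p ⊎ x ≡ p ++ [ i ]
≼-∷ʳ⁻ {x} {p} (s , e) with initLast s
... | [] = inj₂ (trans (sym (++-identityʳ x)) e)
... | s′ ∷ʳ′ a = inj₁ (s′ , ∷ʳ-injectiveˡ (x ++ s′) p (trans (++-assoc x s′ [ a ]) e))

StrictPrefixesSatisfy : (Addr → Set) → Addr → Set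
StrictPrefixesSatisfy P x = ∀ y → y ≼ x → y ≢ x → P y

strictPrefixesSatisfy-∷ʳ : ∀ {P a} b → P a → StrictPrefixesSatisfy P a →
                           StrictPrefixesSatisfy P (a ++ [ b ])
strictPrefixesSatisfy-∷ʳ {a = a} b Pa ps y y≼ y≢ with ≼-∷ʳ⁻ y≼ | y ≟ₐ a
... | inj₂ y≡ | _ = contradiction y≡ y≢
... | inj₁ _ | yes refl = Pa
... | inj₁ y≼a | no y≢a = ps y y≼a y≢a

module _ {P : Addr → Set} (P? : Decidable P) where

  shortestFailingPrefixFrom : ∀ a q → StrictPrefixesSatisfy P a → ¬ P (a ++ q) →
                          ∃ λ x → x ≼ (a ++ q) × ¬ P x × StrictPrefixesSatisfy P x
  shortestFailingPrefixFrom a q ps ¬P with P? a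
  ... | no ¬Pa = a , (q , refl) , ¬Pa , ps
  shortestFailingPrefixFrom a [] ps ¬P | yes Pa = contradiction (subst P (sym (++-identityʳ a)) Pa) ¬P
  shortestFailingPrefixFrom a (b ∷ q) ps ¬P | yes Pa
    with shortestFailingPrefixFrom (a ++ [ b ]) q (strictPrefixesSatisfy-∷ʳ b Pa ps)
           (¬P ∘ subst P (++-assoc a [ b ] q))
  ... | x , x≼ , ¬Px , psx = x , subst (x ≼_) (++-assoc a [ b ] q) x≼ , ¬Px , psx

  shortestFailingPrefix : ∀ p → ¬ P p → ∃ λ x → x ≼ p × ¬ P x × StrictPrefixesSatisfy P x
  shortestFailingPrefix p = shortestFailingPrefixFrom [] p (λ y y≼ y≢ → contradiction (≼-[] y≼) y≢)

++-∈T⁻ : ∀ a b {T} → (a ++ b) ∈T T → a ∈T T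
++-∈T⁻ []      b _          = root
++-∈T⁻ (i ∷ a) b (step h q) = step h (++-∈T⁻ a b q)

≼-∈T : ∀ {x y T} → x ≼ y → y ∈T T → x ∈T T
≼-∈T {x} (s , refl) = ++-∈T⁻ x s

_∈T?_ : ∀ p T → Dec (p ∈T T)
[]      ∈T? T = yes root
(i ∷ p) ∈T? node ts with i <? length ts
... | no i≮ = no λ { (step h _) → i≮ h }
... | yes h with p ∈T? lookup ts (fromℕ< h)
...   | yes q = yes (step h q)
...   | no ¬q = no λ { (step h′ q) →
                       ¬q (subst (λ h → p ∈T lookup ts (fromℕ< h)) (<-irrelevant h′ h) q) }

mutual
  size : Tree → ℕ
  size (node ts) = suc (sizes ts)

  sizes : List Tree → ℕ
  sizes []       = 0
  sizes (t ∷ ts) = size t + sizes ts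

length≤sizes : ∀ ts → length ts ≤ sizes ts
length≤sizes []             = z≤n
length≤sizes (node us ∷ ts) = s≤s (≤-trans (length≤sizes ts) (m≤n+m (sizes ts) (sizes us)))

size-lookup≤sizes : ∀ ts (c : Fin (length ts)) → size (lookup ts c) ≤ sizes ts
size-lookup≤sizes (t ∷ ts) zero    = m≤m+n (size t) (sizes ts)
size-lookup≤sizes (t ∷ ts) (suc c) = ≤-trans (size-lookup≤sizes ts c) (m≤n+m (sizes ts) (size t))

childIndex<size : ∀ v {i T} → (v ++ [ i ]) ∈T T → i < size T
childIndex<size []      (step {ts} h root) = m≤n⇒m≤1+n (≤-trans h (length≤sizes ts))
childIndex<size (_ ∷ v) (step {ts} h q)    =
  m≤n⇒m≤1+n (<-≤-trans (childIndex<size v q) (size-lookup≤sizes ts _))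

explored-mono : ∀ {k} {R : Run k} {s t p i} → s ≤ t → Explored R s p i → Explored R t p i
explored-mono s≤t (u , u<s , tr) = u , <-≤-trans u<s s≤t , tr

module _ {k : ℕ} (R : Run k) where

  trav? : ∀ s p i → Dec (Trav R s p i)
  trav? s p i = (from R s ≟ₐ p ×-dec to R s ≟ₐ (p ++ [ i ]))
                ⊎-dec (to R s ≟ₐ p ×-dec from R s ≟ₐ (p ++ [ i ]))

  explored? : ∀ t p i → Dec (Explored R t p i)
  explored? t p i = anyUpTo? (λ s → trav? s p i) t

  module _ (T : Tree) where

    ChildEdgesExplored ParentEdgeExplored IncidentEdgesExplored : ℕ → Addr → Set
    ChildEdgesExplored s v = ∀ i → (v ++ [ i ]) ∈T T → Explored R s v i
    ParentEdgeExplored s v = ∀ p i → (p ++ [ i ]) ∈T T → v ≡ p ++ [ i ] → Explored R s p i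
    IncidentEdgesExplored s v = ∀ p i → (p ++ [ i ]) ∈T T → Incident v p i → Explored R s p i

    -- Child indices are bounded by size T, so only finitely many child edges need checking.
    childEdgesExplored? : ∀ s v → Dec (ChildEdgesExplored s v)
    childEdgesExplored? s v =
      map′ unbounded (λ all _ h → all _ h)
           (allUpTo? (λ i → ((v ++ [ i ]) ∈T? T) →-dec explored? s v i) (size T))
      where
      unbounded : (∀ {i} → i < size T → (v ++ [ i ]) ∈T T → Explored R s v i) → ChildEdgesExplored s v
      unbounded all i h = all (childIndex<size v h) h

    parentEdgeExplored? : ∀ s v → Dec (ParentEdgeExplored s v)
    parentEdgeExplored? s v with initLast v
    ... | [] = yes λ p i _ e → contradiction (sym e) (∷ʳ≢[] p i)
    ... | p ∷ʳ′ i = map′ onlyParent (λ all h → all p i h refl)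
                         (((p ++ [ i ]) ∈T? T) →-dec explored? s p i)
      where
      onlyParent : ((p ++ [ i ]) ∈T T → Explored R s p i) → ParentEdgeExplored s (p ++ [ i ])
      onlyParent explored p′ i′ h e with ∷ʳ-injective p p′ e
      ... | refl , refl = explored h

    incidentEdgesExplored? : ∀ s v → Dec (IncidentEdgesExplored s v)
    incidentEdgesExplored? s v =
      map′ combine (λ all → (λ i h → all v i h (inj₁ refl)) , (λ p i h e → all p i h (inj₂ e)))
           (childEdgesExplored? s v ×-dec parentEdgeExplored? s v)
      where
      combine : ChildEdgesExplored s v × ParentEdgeExplored s v → IncidentEdgesExplored s v
      combine (children , _)   p i h (inj₁ refl) = children i h
      combine (_ , parent)     p i h (inj₂ e)    = parent p i h e

    mined? : ∀ t v → Dec (Mined R T t v)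
    mined? t v = anyUpTo? (λ s → (from R s ≟ₐ v) ×-dec incidentEdgesExplored? s v) t

    mined⇒incidentExplored : ∀ {t v p i} → Mined R T t v →
                             (p ++ [ i ]) ∈T T → Incident v p i → Explored R t p i
    mined⇒incidentExplored (s , s<t , _ , explored) h inc =
      explored-mono {R = R} (<⇒≤ s<t) (explored _ _ h inc)

EdgeStep : Addr → Addr → Addr → ℕ → Set
EdgeStep a b p i = (a ≡ p × b ≡ p ++ [ i ]) ⊎ (b ≡ p × a ≡ p ++ [ i ])

edgeStep-intoSubtree : ∀ {a b p i y j} → EdgeStep a b p i → (y ++ [ j ]) ≼ b →
                       (y ++ [ j ]) ≼ a ⊎ (a ≡ y × b ≡ y ++ [ j ])
edgeStep-intoSubtree {p = p} {y = y} (inj₁ (refl , refl)) below with ≼-∷ʳ⁻ below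
... | inj₁ below′ = inj₁ below′
... | inj₂ atRoot with ∷ʳ-injective y p atRoot
...   | refl , refl = inj₂ (refl , refl)
edgeStep-intoSubtree (inj₂ (refl , refl)) below = inj₁ (≼-∷ʳ below)

module _ {k : ℕ} {R : Run k} {T : Tree} {t : ℕ} (valid : ValidUpTo R T t) where

  unmoved : ∀ {u} → u < t → ∀ r → r ≢ sched R u → pos R (suc u) r ≡ pos R u r
  unmoved {u} = proj₁ (proj₂ valid) u

  stepsAlongEdge : ∀ {u} → u < t → ∃ λ p → ∃ λ i → Trav R u p i
  stepsAlongEdge {u} u<t = proj₂ (proj₂ (proj₂ valid) u u<t)

  module _ (y : Addr) (j : ℕ) where

    entersSubtreeOnlyDownward : ∀ {u} → u < t → ∀ r → (y ++ [ j ]) ≼ pos R (suc u) r →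
                                (y ++ [ j ]) ≼ pos R u r ⊎ (from R u ≡ y × to R u ≡ y ++ [ j ])
    entersSubtreeOnlyDownward {u} u<t r below with r ≟ᶠ sched R u
    ... | no r≢ = inj₁ (subst ((y ++ [ j ]) ≼_) (unmoved u<t r r≢) below)
    ... | yes refl = edgeStep-intoSubtree (proj₂ (proj₂ (stepsAlongEdge u<t))) below

    leavesSubtreeOnlyUpward : ∀ {u} → u < t → ∀ r → (y ++ [ j ]) ≼ pos R u r →
                              (y ++ [ j ]) ≼ pos R (suc u) r ⊎ (to R u ≡ y × from R u ≡ y ++ [ j ])
    leavesSubtreeOnlyUpward {u} u<t r below with r ≟ᶠ sched R u
    ... | no r≢ = inj₁ (subst ((y ++ [ j ]) ≼_) (sym (unmoved u<t r r≢)) below)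
    ... | yes refl = edgeStep-intoSubtree (swap (proj₂ (proj₂ (stepsAlongEdge u<t)))) below

    inSubtree⇒rootEdgeExplored : ∀ u → u ≤ t → ∀ r → (y ++ [ j ]) ≼ pos R u r → Explored R u y j
    inSubtree⇒rootEdgeExplored zero _ r below =
      contradiction (≼-[] (subst ((y ++ [ j ]) ≼_) (proj₁ valid r) below)) (∷ʳ≢[] y j)
    inSubtree⇒rootEdgeExplored (suc u) u<t r below with entersSubtreeOnlyDownward u<t r below
    ... | inj₁ below′ =
      explored-mono {R = R} (n≤1+n u) (inSubtree⇒rootEdgeExplored u (<⇒≤ u<t) r below′)
    ... | inj₂ down   = u , ≤-refl , inj₁ down

module _ {k : ℕ} {R : Run k} {T : Tree} {t : ℕ}
         (valid : ValidUpTo R T t) (greedy : LocallyGreedyUpTo R T t) where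

  module _ {y : Addr} {j : ℕ} (unmined : ¬ Mined R T t (y ++ [ j ])) where

    neverLeavesUpward : ∀ {u} → u < t → ¬ (to R u ≡ y × from R u ≡ y ++ [ j ])
    neverLeavesUpward {u} u<t up@(_ , fromX) = unmined (u , u<t , fromX , allExplored)
      where
      rootEdgeExplored : Explored R u y j
      rootEdgeExplored = inSubtree⇒rootEdgeExplored valid y j u (<⇒≤ u<t) (sched R u)
                           (subst ((y ++ [ j ]) ≼_) (sym fromX) ≼-refl)

      noUnexploredEdge : ¬ HasUnexploredEdge R T u (from R u)
      noUnexploredEdge unexplored = greedy u u<t unexplored y j (inj₂ up) rootEdgeExplored

      allExplored : IncidentEdgesExplored R T u (y ++ [ j ])
      allExplored p i h inc = decidable-stable (explored? R u p i) λ unexplored →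
        noUnexploredEdge (p , i , h , subst (λ v → Incident v p i) (sym fromX) inc , unexplored)

    staysOccupied : ∀ {u} → u < t → (∃ λ r → (y ++ [ j ]) ≼ pos R u r) →
                    ∃ λ r → (y ++ [ j ]) ≼ pos R (suc u) r
    staysOccupied u<t (r , below) with leavesSubtreeOnlyUpward valid y j u<t r below
    ... | inj₁ below′ = r , below′
    ... | inj₂ up     = contradiction up (neverLeavesUpward u<t)

    occupiedAfterTraversal : ∀ {u} → u < t → Trav R u y j → ∃ λ r → (y ++ [ j ]) ≼ pos R (suc u) r
    occupiedAfterTraversal {u} u<t (inj₁ (_ , toX)) =
      sched R u , subst ((y ++ [ j ]) ≼_) (sym toX) ≼-refl
    occupiedAfterTraversal u<t (inj₂ up) = contradiction up (neverLeavesUpward u<t)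

    rootEdgeExplored⇒occupied : ∀ u → u ≤ t → Explored R u y j → ∃ λ r → (y ++ [ j ]) ≼ pos R u r
    rootEdgeExplored⇒occupied zero _ (_ , () , _)
    rootEdgeExplored⇒occupied (suc u) u<t (s , s<1+u , tr) with m<1+n⇒m<n∨m≡n s<1+u
    ... | inj₁ s<u  = staysOccupied u<t (rootEdgeExplored⇒occupied u (<⇒≤ u<t) (s , s<u , tr))
    ... | inj₂ refl = occupiedAfterTraversal u<t tr

  isAnchorOfSomeRobot : ∀ {x} → x ∈T T → ¬ Mined R T t x → StrictPrefixesSatisfy (Mined R T t) x →
                        ∃ λ r → IsAnchor R T t r x
  isAnchorOfSomeRobot {x} x∈T unmined ancestorsMined with initLast x
  -- The root is the anchor of any robot; sched R 0 : Fin k supplies one.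
  ... | [] = sched R 0 , (pos R t (sched R 0) , refl) , unmined , ancestorsMined
  ... | y ∷ʳ′ j =
    map₂ (_, unmined , ancestorsMined) (rootEdgeExplored⇒occupied unmined t ≤-refl rootEdgeExplored)
    where
    rootEdgeExplored : Explored R t y j
    rootEdgeExplored =
      mined⇒incidentExplored R T (ancestorsMined y ([ j ] , refl) (≢-∷ʳ y j)) x∈T (inj₁ refl)

  unexploredEdge⇒belowAnchor : ∀ p i → (p ++ [ i ]) ∈T T → ¬ Explored R t p i →
                               ∃ λ r → ∃ λ x → IsAnchor R T t r x × x ≼ p
  unexploredEdge⇒belowAnchor p i h unexplored =
    let x , x≼p , unmined , ancestorsMined = shortestFailingPrefix (mined? R T t) p pUnmined
        r , anchor = isAnchorOfSomeRobot (≼-∈T x≼p (++-∈T⁻ p [ i ] h)) unmined ancestorsMined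
    in r , x , anchor , x≼p
    where
    pUnmined : ¬ Mined R T t p
    pUnmined mined = unexplored (mined⇒incidentExplored R T mined h (inj₁ refl))

proposition3p6 : (T : Tree) (k : ℕ) (R : Run k) (t : ℕ) →
    ValidUpTo R T t → LocallyGreedyUpTo R T t →
    (∀ p i → (p ++ [ i ]) ∈T T → ¬ Explored R t p i →
       ∃ λ r → ∃ λ x → IsAnchor R T t r x × x ≼ p)
    × ((∀ r x → ¬ IsAnchor R T t r x) →
       ∀ p i → (p ++ [ i ]) ∈T T → Explored R t p i)
proposition3p6 T k R t valid greedy = belowAnchor , noAnchor⇒explored
  where
  belowAnchor : ∀ p i → (p ++ [ i ]) ∈T T → ¬ Explored R t p i →
                ∃ λ r → ∃ λ x → IsAnchor R T t r x × x ≼ p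
  belowAnchor = unexploredEdge⇒belowAnchor valid greedy

  noAnchor⇒explored : (∀ r x → ¬ IsAnchor R T t r x) → ∀ p i → (p ++ [ i ]) ∈T T → Explored R t p i
  noAnchor⇒explored noAnchor p i h = decidable-stable (explored? R t p i) λ unexplored →
    let r , x , anchor , _ = belowAnchor p i h unexplored in noAnchor r x anchor
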